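{- Work constructively (intuitionistic logic with countable choice). Let $(f_n)_{n \geq 1}$ be a sequence of functions $f_n : \mathbb{N}_\infty \to \mathbb{N}$ such that $f_n(x) \to 0$ for every $x \in \mathbb{N}_\infty$. Then either - there exists $N \in \mathbb{N}$ such that $f_i(\alpha) = 0$ for all $i \geq N$ and all $\alpha \in \mathbb{N}_\infty$ with $\alpha \geq \underline{N}$; - or there exist a sequence $(\alpha_n)_{n\ge1}$ in $\mathbb{N}_\infty$ and a sequence $(k_n)_{n\ge1}$ of natural numbers such that for every $n$: $k_n \geq n$, $\alpha_n \geq \underline{n}$, and $f_{k_n}(\alpha_n) \neq 0$.
   Context: $\mathbb{N}_\infty$ is the set of all increasing binary sequences $\alpha : \mathbb{N} \to \{0,1\}$, with the metric inherited from Cantor space. For $n \in \mathbb{N}$, $\underline{n} \in \mathbb{N}_\infty$ is the sequence $0^n 1 1 1 \dots$ (first $n$ terms $0$, all later terms $1$), and $\omega = 000\dots$. $\mathbb{N}_\infty$ carries the reverse lexicographic order, so for $\alpha \in \mathbb{N}_\infty$, $\alpha \geq \underline{n}$ means that the first $n$ terms of $\alpha$ are $0$. Since $\mathbb{N}$ is discrete, $f_n(x) \to 0$ means $f_n(x) = 0$ for all sufficiently large $n$. The disjunction is constructive. -}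

module Defs where

open import Data.Bool using (Bool; true; false; _≤_)
open import Data.Nat using (ℕ; suc; _<_)
open import Data.Product using (Σ)
open import Relation.Binary.PropositionalEquality using (_≡_)

-- ℕ∞ : increasing binary sequences (false = 0, true = 1)
record ℕ∞ : Set where
  constructor mkℕ∞
  field
    seq : ℕ → Bool
    increasing : ∀ n → seq n ≤ seq (suc n)
open ℕ∞ public

_≈∞_ : ℕ∞ → ℕ∞ → Set
α ≈∞ β = ∀ i → seq α i ≡ seq β i

_≥ₙ_ : ℕ∞ → ℕ → Set
α ≥ₙ n = ∀ i → i < n → seq α i ≡ false

Extensional : (ℕ∞ → ℕ) → Set
Extensional g = ∀ α β → α ≈∞ β → g α ≡ g β

-- For each N, the predicate "α ≥ N implies f_i(α) = 0 for all i ≥ N" is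
-- decidable (convergence at α bounds the i that need checking) and invariant,
-- so by Escardó's omniscience of ℕ∞ either N is settled or it has a
-- counterexample (i, α). Settledness is upward closed, hence itself a point c
-- of ℕ∞. Gluing the counterexample points along c gives a point x that equals
-- the counterexample at m whenever m + 1 is the first settled index.
-- Convergence at x yields K, and no index beyond K + 1 can be the first settled
-- one: its counterexample at x would have f_i(x) = 0. So either K + 1 is
-- settled or no N is, and then every N has a counterexample.
module Submission where

open import Defs
open import Data.Nat using (ℕ; _≤_; _≥_)
open import Data.Product using (Σ; _×_)
open import Data.Sum using (_⊎_)
open import Relation.Binary.PropositionalEquality using (_≡_; _≢_)

open import Data.Bool.Base using (Bool; true; false; b≤b) renaming (_≤_ to _≤ᴮ_)
import Data.Bool.Properties as 𝔹
open import Data.Nat.Base using (zero; suc; _<_; _+_; s≤s; _≤′_; ≤′-refl; ≤′-step)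
open import Data.Nat.Induction using (<-rec)
open import Data.Nat.Properties
  using (_≤?_; _<?_; _≟_; ≤-refl; ≤-trans; ≤-antisym; ≤-pred; n≤1+n; m≤n+m; m≤n⇒m≤1+n;
         m<n⇒m<1+n; <-≤-trans; <⇒≱; ≰⇒>; ≮⇒≥; ≤⇒≤′; anyUpTo?; allUpTo?)
open import Data.Product using (∃; _,_; proj₁; proj₂)
open import Data.Empty using (⊥)
open import Data.Sum using (inj₁; inj₂; map₂; [_,_]′)
open import Function using (_∘_)
open import Relation.Nullary using (Dec; yes; no; does; ¬_; contradiction)
open import Relation.Nullary.Decidable
  using (dec-true; dec-false; decidable-stable; fromSum; map′; ¬?; _×-dec_; _→-dec_)
open import Relation.Binary.PropositionalEquality using (refl; sym; trans; subst)

private variable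
  A B : Set
  Q : ℕ → Set
  c : ℕ∞
  i j k m n M N : ℕ

dec-true⁻¹ : (a? : Dec A) → does a? ≡ true → A
dec-true⁻¹ (yes a) _ = a

dec-false⁻¹ : (a? : Dec A) → does a? ≡ false → ¬ A
dec-false⁻¹ (no ¬a) _ = ¬a

does-mono : (A → B) → (a? : Dec A) (b? : Dec B) → does a? ≤ᴮ does b?
does-mono _ (no _)  b?      = 𝔹.≤-minimum (does b?)
does-mono _ (yes _) (yes _) = b≤b
does-mono f (yes a) (no ¬b) = contradiction (f a) ¬b

≤ᴮ-true : {a b : Bool} → a ≤ᴮ b → a ≡ true → b ≡ true
≤ᴮ-true b≤b a≡true = a≡true

≈∞-sym : ∀ α β → α ≈∞ β → β ≈∞ α
≈∞-sym _ _ α≈β i = sym (α≈β i)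

fromUpward : (Q : ℕ → Set) → (∀ j → Dec (Q j)) → (∀ {j} → Q j → Q (suc j)) → ℕ∞
fromUpward Q Q? up = mkℕ∞ (does ∘ Q?) (λ j → does-mono up (Q? j) (Q? (suc j)))

fin : ℕ → ℕ∞
fin k = fromUpward (k ≤_) (k ≤?_) m≤n⇒m≤1+n

ω : ℕ∞
ω = mkℕ∞ (λ _ → false) (λ _ → b≤b)

fin-true : k ≤ j → seq (fin k) j ≡ true
fin-true {k} {j} = dec-true (k ≤? j)

fin-false : j < k → seq (fin k) j ≡ false
fin-false {j} {k} = dec-false (k ≤? j) ∘ <⇒≱

fin-true⁻¹ : seq (fin k) j ≡ true → k ≤ j
fin-true⁻¹ {k} {j} = dec-true⁻¹ (k ≤? j)

fin-false⁻¹ : seq (fin k) j ≡ false → j < k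
fin-false⁻¹ {k} {j} = ≰⇒> ∘ dec-false⁻¹ (k ≤? j)

seq-monotone : (α : ℕ∞) → i ≤ j → seq α i ≡ true → seq α j ≡ true
seq-monotone α = go ∘ ≤⇒≤′
  where
  go : i ≤′ j → seq α i ≡ true → seq α j ≡ true
  go ≤′-refl             αi = αi
  go (≤′-step {n} i≤′n) αi = ≤ᴮ-true (increasing α n) (go i≤′n αi)

false⇒≥ₙ : (α : ℕ∞) → seq α j ≡ false → α ≥ₙ suc j
false⇒≥ₙ α αj i (s≤s i≤j) with seq α i in αi
... | false = refl
... | true  = contradiction (trans (sym (seq-monotone α i≤j αi)) αj) λ ()

≈fin : (α : ℕ∞) → α ≥ₙ k → seq α k ≡ true → α ≈∞ fin k
≈fin {k} α α≥k αk j with k ≤? j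
... | yes k≤j = trans (seq-monotone α k≤j αk) (sym (fin-true k≤j))
... | no  k≰j = trans (α≥k j (≰⇒> k≰j)) (sym (fin-false (≰⇒> k≰j)))

true⇒≈fin : (α : ℕ∞) → seq α j ≡ true → ∃ λ k → α ≈∞ fin k
true⇒≈fin {zero}  α α0 = 0 , ≈fin α (λ _ ()) α0
true⇒≈fin {suc j} α αj+1 with seq α j in αj
... | true  = true⇒≈fin α αj
... | false = suc j , ≈fin α (false⇒≥ₙ α αj) αj+1

firstWhere : (Q : ℕ → Set) → (∀ i → Dec (Q i)) → ℕ∞
firstWhere Q Q? =
  fromUpward (λ j → ∃ λ i → i < suc j × Q i) (anyUpTo? Q? ∘ suc)
             (λ (i , i<1+j , Qi) → i , m<n⇒m<1+n i<1+j , Qi)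

firstWhere-≈fin : (Q? : ∀ i → Dec (Q i)) → (∀ {i} → i < k → ¬ Q i) → Q k →
                  firstWhere Q Q? ≈∞ fin k
firstWhere-≈fin {Q} {k} Q? none Qk =
  ≈fin (firstWhere Q Q?) below (dec-true (anyUpTo? Q? (suc k)) (k , ≤-refl , Qk))
  where
  below : firstWhere Q Q? ≥ₙ k
  below j j<k =
    dec-false (anyUpTo? Q? (suc j)) λ (i , i<1+j , Qi) → none (<-≤-trans i<1+j j<k) Qi

firstWhere-≈ω : (Q? : ∀ i → Dec (Q i)) → (∀ i → ¬ Q i) → firstWhere Q Q? ≈∞ ω
firstWhere-≈ω Q? none j = dec-false (anyUpTo? Q? (suc j)) λ (i , _ , Qi) → none i Qi

module _ {P : ℕ∞ → Set} (P? : ∀ α → Dec (P α))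
         (P-resp : ∀ α β → α ≈∞ β → P α → P β) where

  ℕ∞-density : (∀ k → P (fin k)) → P ω → ∀ α → P α
  ℕ∞-density Pfin Pω α with P? α
  ... | yes Pα = Pα
  ... | no ¬Pα = contradiction (P-resp ω α ω≈α Pω) ¬Pα
    where
    ω≈α : ω ≈∞ α
    ω≈α j with seq α j in αj
    ... | false = refl
    ... | true  with true⇒≈fin α αj
    ...   | k , α≈k = contradiction (P-resp (fin k) α (≈∞-sym α (fin k) α≈k) (Pfin k)) ¬Pα

  -- ε is fin k for the least k with ¬ P (fin k), and ω if there is none.
  private
    ε : ℕ∞
    ε = firstWhere (λ k → ¬ P (fin k)) (¬? ∘ P? ∘ fin)

  ε-holds⇒fin-holds : P ε → ∀ k → P (fin k)
  ε-holds⇒fin-holds Pε = <-rec (P ∘ fin) step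
    where
    step : ∀ k → (∀ {i} → i < k → P (fin i)) → P (fin k)
    step k below with P? (fin k)
    ... | yes Pk = Pk
    ... | no ¬Pk = contradiction (P-resp ε (fin k) ε≈k Pε) ¬Pk
      where
      ε≈k : ε ≈∞ fin k
      ε≈k = firstWhere-≈fin (¬? ∘ P? ∘ fin) (λ i<k ¬Pi → ¬Pi (below i<k)) ¬Pk

  ℕ∞-omniscient : (∀ α → P α) ⊎ ∃ λ α → ¬ P α
  ℕ∞-omniscient with P? ε
  ... | no ¬Pε = inj₂ (ε , ¬Pε)
  ... | yes Pε = inj₁ (ℕ∞-density Pfin (P-resp ε ω ε≈ω Pε))
    where
    Pfin : ∀ k → P (fin k)
    Pfin = ε-holds⇒fin-holds Pε
    ε≈ω : ε ≈∞ ω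
    ε≈ω = firstWhere-≈ω (¬? ∘ P? ∘ fin) λ k ¬Pk → ¬Pk (Pfin k)

Jump : ℕ∞ → ℕ → Set
Jump c m = seq c m ≡ false × seq c (suc m) ≡ true

jump? : (c : ℕ∞) → ∀ m → Dec (Jump c m)
jump? c m = (seq c m 𝔹.≟ false) ×-dec (seq c (suc m) 𝔹.≟ true)

Jump-≈fin⁺ : c ≈∞ fin (suc m) → Jump c m
Jump-≈fin⁺ {m = m} c≈ =
  trans (c≈ m) (fin-false {m} ≤-refl) , trans (c≈ (suc m)) (fin-true {suc m} ≤-refl)

Jump-≈fin⁻ : c ≈∞ fin (suc m) → Jump c i → i ≡ m
Jump-≈fin⁻ {i = i} c≈ (ci , ci+1) =
  ≤-antisym (≤-pred (fin-false⁻¹ (trans (sym (c≈ i)) ci)))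
            (≤-pred (fin-true⁻¹ (trans (sym (c≈ (suc i))) ci+1)))

GlueWitness : (ℕ → ℕ∞) → ℕ∞ → ℕ → ℕ → Set
GlueWitness β c j m = Jump c m × seq (β m) j ≡ true

glueWitness? : ∀ β c j m → Dec (GlueWitness β c j m)
glueWitness? β c j m = jump? c m ×-dec (seq (β m) j 𝔹.≟ true)

-- The continuous extension of fin (suc m) ↦ β m to ℕ∞ (with ω ↦ ω); it is
-- well defined because β m ≥ₙ m makes β m converge to ω.
glue : (ℕ → ℕ∞) → ℕ∞ → ℕ∞
glue β c =
  fromUpward (λ j → ∃ λ m → m < suc j × GlueWitness β c j m)
             (λ j → anyUpTo? (glueWitness? β c j) (suc j))
             (λ (m , m<1+j , jump , βmj) →
                m , m<n⇒m<1+n m<1+j , jump , ≤ᴮ-true (increasing (β m) _) βmj)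

glue-≈ : (β : ℕ → ℕ∞) → c ≈∞ fin (suc m) → β m ≥ₙ m → glue β c ≈∞ β m
glue-≈ {c} {m} β c≈ βm≥m j with seq (β m) j in βmj
... | true  = dec-true (anyUpTo? (glueWitness? β c j) (suc j))
                       (m , s≤s m≤j , Jump-≈fin⁺ {c = c} {m = m} c≈ , βmj)
  where
  m≤j : m ≤ j
  m≤j = ≮⇒≥ λ j<m → contradiction (trans (sym βmj) (βm≥m j j<m)) λ ()
... | false = dec-false (anyUpTo? (glueWitness? β c j) (suc j)) λ (i , _ , jump , βij) →
  let βmj≡true = subst (λ i → seq (β i) j ≡ true) (Jump-≈fin⁻ {c = c} {m = m} c≈ jump) βij
  in contradiction (trans (sym βmj≡true) βmj) λ ()

VanishesFrom : (ℕ → ℕ) → ℕ → Set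
VanishesFrom g N = ∀ n → 1 ≤ n → n ≥ N → g n ≡ 0

vanishesFrom⊎witness : {g : ℕ → ℕ} → VanishesFrom g M → ∀ N →
                       VanishesFrom g N ⊎ ∃ λ n → 1 ≤ n × n ≥ N × g n ≢ 0
vanishesFrom⊎witness {M} {g} g→0 N
  with anyUpTo? (λ n → (1 ≤? n) ×-dec (N ≤? n) ×-dec ¬? (g n ≟ 0)) (N + M)
... | yes (n , _ , witness) = inj₂ (n , witness)
... | no none = inj₁ vanishes
  where
  vanishes : VanishesFrom g N
  vanishes n 1≤n n≥N with n <? N + M
  ... | yes n<N+M =
    decidable-stable (g n ≟ 0) λ gn≢0 → none (n , n<N+M , 1≤n , n≥N , gn≢0)
  ... | no  n≮N+M = g→0 n 1≤n (≤-trans (m≤n+m M N) (≮⇒≥ n≮N+M))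

vanishesFrom? : {g : ℕ → ℕ} → VanishesFrom g M → ∀ N → Dec (VanishesFrom g N)
vanishesFrom? g→0 N =
  fromSum (map₂ (λ (n , 1≤n , n≥N , gn≢0) v → gn≢0 (v n 1≤n n≥N))
                (vanishesFrom⊎witness g→0 N))

≥ₙ? : ∀ α N → Dec (α ≥ₙ N)
≥ₙ? α N = map′ (λ h i → h {i}) (λ h {i} → h i) (allUpTo? (λ i → seq α i 𝔹.≟ false) N)

module _ (f : ℕ → ℕ∞ → ℕ) (f-ext : ∀ n → Extensional (f n))
         (f→0 : ∀ α → Σ ℕ (VanishesFrom (λ n → f n α))) where

  Settled : ℕ → Set
  Settled N = ∀ i → 1 ≤ i → i ≥ N → ∀ α → α ≥ₙ N → f i α ≡ 0

  record Counterexample (N : ℕ) : Set where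
    field
      index   : ℕ
      point   : ℕ∞
      1≤index : 1 ≤ index
      index≥N : index ≥ N
      point≥N : point ≥ₙ N
      value≢0 : f index point ≢ 0

  SettledAt : ℕ → ℕ∞ → Set
  SettledAt N α = α ≥ₙ N → VanishesFrom (λ i → f i α) N

  settledAt? : ∀ N α → Dec (SettledAt N α)
  settledAt? N α = ≥ₙ? α N →-dec vanishesFrom? (proj₂ (f→0 α)) N

  settledAt-resp : ∀ α β → α ≈∞ β → SettledAt N α → SettledAt N β
  settledAt-resp α β α≈β Sα β≥N n 1≤n n≥N =
    trans (f-ext n β α (≈∞-sym α β α≈β)) (Sα (λ i i<N → trans (α≈β i) (β≥N i i<N)) n 1≤n n≥N)

  settled⊎counterexample : ∀ N → Settled N ⊎ Counterexample N
  settled⊎counterexample N with ℕ∞-omniscient (settledAt? N) settledAt-resp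
  ... | inj₁ all = inj₁ λ i 1≤i i≥N α α≥N → all α α≥N i 1≤i i≥N
  ... | inj₂ (α , ¬Sα) with ≥ₙ? α N | vanishesFrom⊎witness (proj₂ (f→0 α)) N
  ...   | no α≱N  | _      = contradiction (λ α≥N → contradiction α≥N α≱N) ¬Sα
  ...   | yes _   | inj₁ v = contradiction (λ _ → v) ¬Sα
  ...   | yes α≥N | inj₂ (i , 1≤i , i≥N , fiα≢0) =
    inj₂ (record { index = i ; point = α ; 1≤index = 1≤i ; index≥N = i≥N
                 ; point≥N = α≥N ; value≢0 = fiα≢0 })

  counterexample⇒¬settled : Counterexample N → ¬ Settled N
  counterexample⇒¬settled w s = value≢0 (s index 1≤index index≥N point point≥N)
    where open Counterexample w

  ¬settled⇒counterexample : ∀ N → ¬ Settled N → Counterexample N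
  ¬settled⇒counterexample N ¬s with settled⊎counterexample N
  ... | inj₁ s = contradiction s ¬s
  ... | inj₂ w = w

  settled? : ∀ N → Dec (Settled N)
  settled? N = fromSum (map₂ counterexample⇒¬settled (settled⊎counterexample N))

  settled-suc : Settled N → Settled (suc N)
  settled-suc {N} s i 1≤i i>N α α>N =
    s i 1≤i (≤-trans (n≤1+n N) i>N) α (λ j j<N → α>N j (m<n⇒m<1+n j<N))

  firstSettled : ℕ∞
  firstSettled = fromUpward Settled settled? settled-suc

  pointOf : Settled m ⊎ Counterexample m → ℕ∞
  pointOf (inj₁ _) = ω
  pointOf (inj₂ w) = Counterexample.point w

  pointOf-≥ₙ : (d : Settled m ⊎ Counterexample m) → pointOf d ≥ₙ m
  pointOf-≥ₙ (inj₁ _) _ _ = refl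
  pointOf-≥ₙ (inj₂ w)     = Counterexample.point≥N w

  x : ℕ∞
  x = glue (pointOf ∘ settled⊎counterexample) firstSettled

  K : ℕ
  K = proj₁ (f→0 x)

  x≉late-pointOf : (d : Settled m ⊎ Counterexample m) → suc K ≤ m → ¬ Settled m → x ≈∞ pointOf d → ⊥
  x≉late-pointOf (inj₁ s) _     ¬s _   = ¬s s
  x≉late-pointOf (inj₂ w) 1+K≤m _  x≈w =
    value≢0 (trans (f-ext index point x (≈∞-sym x point x≈w))
                   (proj₂ (f→0 x) index 1≤index (≤-trans (n≤1+n K) (≤-trans 1+K≤m index≥N))))
    where open Counterexample w

  firstSettled≉late-fin : suc K < n → ¬ firstSettled ≈∞ fin n
  firstSettled≉late-fin {suc m} (s≤s 1+K≤m) c≈ =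
    x≉late-pointOf (settled⊎counterexample m) 1+K≤m
      (dec-false⁻¹ (settled? m) (trans (c≈ m) (fin-false {m} ≤-refl)))
      (glue-≈ {firstSettled} {m} (pointOf ∘ settled⊎counterexample) c≈
              (pointOf-≥ₙ (settled⊎counterexample m)))

  ¬settled[1+K]⇒¬settled : ¬ Settled (suc K) → ¬ Settled N
  ¬settled[1+K]⇒¬settled {N} ¬s1+K sN = firstSettled≉late-fin 1+K<first c≈first
    where
    first-settled : ∃ λ first → firstSettled ≈∞ fin first
    first-settled = true⇒≈fin {N} firstSettled (dec-true (settled? N) sN)
    first : ℕ
    first = proj₁ first-settled
    c≈first : firstSettled ≈∞ fin first
    c≈first = proj₂ first-settled
    1+K<first : suc K < first
    1+K<first = fin-false⁻¹ {first} {suc K}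
                  (trans (sym (c≈first (suc K))) (dec-false (settled? (suc K)) ¬s1+K))

  counterexamples-everywhere : (∀ {N} → ¬ Settled N) →
    Σ (ℕ → ℕ∞) λ α → Σ (ℕ → ℕ) λ k → ∀ n → 1 ≤ n → (k n ≥ n) × (α n ≥ₙ n) × (f (k n) (α n) ≢ 0)
  counterexamples-everywhere ¬s =
    point ∘ cex , index ∘ cex , λ n _ → index≥N (cex n) , point≥N (cex n) , value≢0 (cex n)
    where
    open Counterexample
    cex : ∀ N → Counterexample N
    cex N = ¬settled⇒counterexample N ¬s

  -- No `with` on terms containing K (here or above): with-abstraction then
  -- normalises the glued point x, which is prohibitively slow.
  dichotomy : Σ ℕ Settled ⊎ (Σ (ℕ → ℕ∞) λ α → Σ (ℕ → ℕ) λ k →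
                ∀ n → 1 ≤ n → (k n ≥ n) × (α n ≥ₙ n) × (f (k n) (α n) ≢ 0))
  dichotomy =
    [ (λ s → inj₁ (suc K , s))
    , (λ w → inj₂ (counterexamples-everywhere (¬settled[1+K]⇒¬settled (counterexample⇒¬settled w))))
    ]′ (settled⊎counterexample (suc K))

theorem6 : (f : ℕ → ℕ∞ → ℕ)
    → (∀ n → Extensional (f n))
    → (∀ x → Σ ℕ λ M → ∀ n → 1 ≤ n → n ≥ M → f n x ≡ 0)
    → (Σ ℕ λ N → ∀ i → 1 ≤ i → i ≥ N → ∀ α → α ≥ₙ N → f i α ≡ 0)
      ⊎ (Σ (ℕ → ℕ∞) λ α → Σ (ℕ → ℕ) λ k →
           ∀ n → 1 ≤ n → (k n ≥ n) × (α n ≥ₙ n) × (f (k n) (α n) ≢ 0))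
theorem6 = dichotomy
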